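{- Let $n \ge 1$ and $0 \le \tau \le n-1$ be integers, and let $\{p(\tau)\}_n$ denote the number of partitions of $n$ whose largest part equals $n-\tau$. Set $\lambda = 2\tau - n$ if $2\tau - n > 0$ and $\lambda = 0$ if $2\tau - n \le 0$. Then $$\{p(\tau)\}_n \;=\; p(\tau) \;-\; \sum_{i=0}^{\lambda-1} \{p(i)\}_{\tau},$$ where the sum is empty when $\lambda = 0$. In other words, the term $\{p(\tau)\}_n$ has exactly $\lambda = \max(2\tau-n,0)$ subtracted terms, namely $\{p(0)\}_\tau, \{p(1)\}_\tau, \dots, \{p(\lambda-1)\}_\tau$.
   Context: $p(m)$ denotes the number of partitions of the integer $m$, with the conventions $p(0)=1$ and $p(m)=0$ for $m<0$. The paper writes $p(n)=\sum_{i=0}^{n-1}\{p(i)\}$, where the term $\{p(i)\}$ is the number of partitions of $n$ whose largest part is $n-i$. In the paper's terminology, $\{p(\tau)\}$ is a "parcel" whose "father-parcel" is $p(n)$. The parcel is written as $p(\tau)$ minus its "child-parcels" $\{p(0)\},\dots,\{p(\lambda-1)\}$, and each child-parcel $\{p(i)\}$ is taken relative to $\tau$, i.e. it is the number of partitions of $\tau$ whose largest part is $\tau-i$. This rigorous reading of the paper's informal parcel/cell statement is the one confirmed by the paper's worked expansion of $p(10)$. -}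

module Defs where

open import Data.Nat using (ℕ; zero; suc; _+_; _∸_; _≥_; _⊔_)
open import Data.List using (List; []; _∷_)
open import Data.Nat.ListAction using (sum)
open import Data.List.Relation.Unary.All using (All)
open import Data.Fin using (Fin)
open import Data.Product using (Σ; _×_)
open import Function.Bundles using (_↔_)
open import Relation.Binary.PropositionalEquality using (_≡_)

data NonIncreasing : List ℕ → Set where
  []  : NonIncreasing []
  [_] : ∀ x → NonIncreasing (x ∷ [])
  _∷_ : ∀ {x y ys} → x ≥ y → NonIncreasing (y ∷ ys) → NonIncreasing (x ∷ y ∷ ys)

IsPartition : ℕ → List ℕ → Set
IsPartition m xs = NonIncreasing xs × All (λ x → x ≥ 1) xs × sum xs ≡ m

largest : List ℕ → ℕ
largest []      = 0
largest (x ∷ _) = x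

Partition : ℕ → Set
Partition m = Σ (List ℕ) (IsPartition m)

PartitionLargest : ℕ → ℕ → Set
PartitionLargest m k = Σ (List ℕ) (λ xs → IsPartition m xs × largest xs ≡ k)

HasCard : Set → ℕ → Set
HasCard A c = Fin c ↔ A

sumBelow : ℕ → (ℕ → ℕ) → ℕ
sumBelow zero    f = 0
sumBelow (suc l) f = sumBelow l f + f l

-- λ = max(2τ - n, 0) (truncated subtraction on ℕ)
lam : ℕ → ℕ → ℕ
lam n τ = (τ + τ) ∸ n

-- Removing the largest part c from a partition of c + m leaves a partition
-- of m with all parts at most c, and this is a bijection.  Partitions of τ
-- with largest part at most d are all of them except those whose largest
-- part is τ, τ - 1, …, d + 1, i.e. the τ ∸ d parcels {p(i)}_τ with i < τ ∸ d.
-- With d = n - τ, so that n = d + τ, this gives the claim, because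
-- λ = 2τ ∸ n = τ ∸ (n ∸ τ).
module Submission where

open import Defs
open import Data.Nat using (ℕ; zero; suc; _+_; _∸_; _≤_; _<_; z≤n)
open import Data.Nat.Properties
open import Data.Nat.ListAction using (sum)
open import Data.List using (List; []; _∷_)
open import Data.List.Relation.Unary.All as All using (_∷_)
open import Data.Product using (Σ; _×_; _,_; proj₁)
open import Data.Product.Algebra using (×-cong; ×-distribˡ-⊎)
open import Data.Product.Function.Dependent.Propositional using (Σ-↔)
open import Data.Sum using (_⊎_; inj₁; inj₂; [_,_]′; map₁)
open import Data.Sum.Algebra using (⊎-cong; ⊎-assoc; ⊎-comm; ⊎-identityʳ)
open import Data.Empty using (⊥-elim)
open import Data.Empty.Polymorphic using (⊥)
open import Data.Fin using (Fin)
open import Data.Fin.Properties using (+↔⊎)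
open import Data.Fin.Permutation using (↔⇒≡)
open import Function.Bundles using (_↔_; mk↔ₛ′)
open import Function.Properties.Inverse using (↔-refl; ↔-sym; ↔-trans)
open import Function.Related.Propositional using (module EquationalReasoning)
open import Function.Related.TypeIsomorphisms using (Σ-distribˡ-⊎)
open import Level using (0ℓ)
open import Relation.Nullary using (¬_)
open import Relation.Nullary.Irrelevant using (Irrelevant)
open import Relation.Binary.PropositionalEquality

private
  variable
    A B : Set

×-irrelevant : Irrelevant A → Irrelevant B → Irrelevant (A × B)
×-irrelevant irrA irrB (a , b) (a′ , b′) = cong₂ _,_ (irrA a a′) (irrB b b′)

⊎-irrelevant : ¬ (A × B) → Irrelevant A → Irrelevant B → Irrelevant (A ⊎ B)
⊎-irrelevant _    irrA _    (inj₁ a) (inj₁ a′) = cong inj₁ (irrA a a′)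
⊎-irrelevant _    _    irrB (inj₂ b) (inj₂ b′) = cong inj₂ (irrB b b′)
⊎-irrelevant A∩B  _    _    (inj₁ a) (inj₂ b)  = ⊥-elim (A∩B (a , b))
⊎-irrelevant A∩B  _    _    (inj₂ b) (inj₁ a)  = ⊥-elim (A∩B (a , b))

irrelevant-⇔⇒↔ : Irrelevant A → Irrelevant B → (A → B) → (B → A) → A ↔ B
irrelevant-⇔⇒↔ irrA irrB to from =
  mk↔ₛ′ to from (λ b → irrB _ b) (λ a → irrA _ a)

≤-suc↔≤⊎≡ : ∀ {x k} → (x ≤ suc k) ↔ (x ≤ k ⊎ x ≡ suc k)
≤-suc↔≤⊎≡ = irrelevant-⇔⇒↔ ≤-irrelevant
  (⊎-irrelevant (λ { (x≤k , refl) → 1+n≰n x≤k }) ≤-irrelevant ≡-irrelevant)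
  (λ x≤1+k → map₁ ≤-pred (m≤n⇒m<n∨m≡n x≤1+k))
  [ m≤n⇒m≤1+n , ≤-reflexive ]′

NonIncreasing-irrelevant : ∀ {xs} → Irrelevant (NonIncreasing xs)
NonIncreasing-irrelevant []        []          = refl
NonIncreasing-irrelevant [ x ]     [ .x ]      = refl
NonIncreasing-irrelevant (x≥y ∷ p) (x≥y′ ∷ p′) =
  cong₂ _∷_ (≤-irrelevant x≥y x≥y′) (NonIncreasing-irrelevant p p′)

IsPartition-irrelevant : ∀ {m xs} → Irrelevant (IsPartition m xs)
IsPartition-irrelevant = ×-irrelevant NonIncreasing-irrelevant
  (×-irrelevant (All.irrelevant ≤-irrelevant) ≡-irrelevant)

NonIncreasing-tail : ∀ {x xs} → NonIncreasing (x ∷ xs) → NonIncreasing xs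
NonIncreasing-tail [ _ ]   = []
NonIncreasing-tail (_ ∷ p) = p

NonIncreasing-largest≤head : ∀ {x xs} → NonIncreasing (x ∷ xs) → largest xs ≤ x
NonIncreasing-largest≤head [ _ ]     = z≤n
NonIncreasing-largest≤head (x≥y ∷ _) = x≥y

NonIncreasing-cons : ∀ {x xs} → largest xs ≤ x → NonIncreasing xs →
                     NonIncreasing (x ∷ xs)
NonIncreasing-cons {x} _   []        = [ x ]
NonIncreasing-cons     x≥y [ y ]     = x≥y ∷ [ y ]
NonIncreasing-cons     x≥y (y≥z ∷ p) = x≥y ∷ (y≥z ∷ p)

largest≤sum : ∀ xs → largest xs ≤ sum xs
largest≤sum []       = z≤n
largest≤sum (x ∷ xs) = m≤m+n x (sum xs)

PartitionAtMost : ℕ → ℕ → Set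
PartitionAtMost m k = Σ (List ℕ) (λ xs → IsPartition m xs × largest xs ≤ k)

Partition↔PartitionAtMost : ∀ {m k} → m ≤ k → Partition m ↔ PartitionAtMost m k
Partition↔PartitionAtMost {m} {k} m≤k = Σ-↔ ↔-refl λ {xs} → irrelevant-⇔⇒↔
  IsPartition-irrelevant (×-irrelevant IsPartition-irrelevant ≤-irrelevant)
  (λ p → p , largest≤k xs p) proj₁
  where
  largest≤k : ∀ xs → IsPartition m xs → largest xs ≤ k
  largest≤k xs (_ , _ , sum≡m) =
    ≤-trans (≤-trans (largest≤sum xs) (≤-reflexive sum≡m)) m≤k

PartitionAtMost-suc : ∀ m {j k} → j ≡ suc k →
  PartitionAtMost m j ↔ (PartitionAtMost m k ⊎ PartitionLargest m j)
PartitionAtMost-suc m refl = ↔-trans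
  (Σ-↔ ↔-refl (↔-trans (×-cong ↔-refl ≤-suc↔≤⊎≡) (×-distribˡ-⊎ 0ℓ _ _ _)))
  Σ-distribˡ-⊎

PartitionLargest↔PartitionAtMost : ∀ {c m} → 1 ≤ c →
  PartitionLargest (c + m) c ↔ PartitionAtMost m c
PartitionLargest↔PartitionAtMost {c} {m} c≥1 = mk↔ₛ′ drop cons drop∘cons cons∘drop
  where
  drop : PartitionLargest (c + m) c → PartitionAtMost m c
  drop ([] , _ , 0≡c) = ⊥-elim (<⇒≢ c≥1 0≡c)
  drop (x ∷ xs , (ni , _ ∷ pos , sum≡) , refl) =
    xs , (NonIncreasing-tail ni , pos , +-cancelˡ-≡ x _ _ sum≡) ,
    NonIncreasing-largest≤head ni
  cons : PartitionAtMost m c → PartitionLargest (c + m) c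
  cons (xs , (ni , pos , sum≡) , xs≤c) =
    c ∷ xs , (NonIncreasing-cons xs≤c ni , c≥1 ∷ pos , cong (c +_) sum≡) , refl
  drop∘cons : ∀ ys → drop (cons ys) ≡ ys
  drop∘cons (xs , _) =
    cong (xs ,_) (×-irrelevant IsPartition-irrelevant ≤-irrelevant _ _)
  cons∘drop : ∀ ys → cons (drop ys) ≡ ys
  cons∘drop ([] , _ , 0≡c) = ⊥-elim (<⇒≢ c≥1 0≡c)
  cons∘drop (x ∷ xs , (_ , _ ∷ _ , _) , refl) =
    cong (x ∷ xs ,_) (×-irrelevant IsPartition-irrelevant ≡-irrelevant _ _)

-- ParcelSum m l = {p(0)}_m ⊎ … ⊎ {p(l-1)}_m
ParcelSum : ℕ → ℕ → Set
ParcelSum m zero    = ⊥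
ParcelSum m (suc l) = ParcelSum m l ⊎ PartitionLargest m (m ∸ l)

ParcelSum-card : ∀ {m} (q : ℕ → ℕ) →
  (∀ i → HasCard (PartitionLargest m (m ∸ i)) (q i)) →
  ∀ l → HasCard (ParcelSum m l) (sumBelow l q)
ParcelSum-card q card zero    = mk↔ₛ′ (λ ()) (λ ()) (λ ()) (λ ())
ParcelSum-card q card (suc l) = ↔-trans +↔⊎ (⊎-cong (ParcelSum-card q card l) (card l))

PartitionAtMost-split : ∀ m l → l ≤ m →
  PartitionAtMost m m ↔ (PartitionAtMost m (m ∸ l) ⊎ ParcelSum m l)
PartitionAtMost-split m zero    _   = ↔-sym (⊎-identityʳ 0ℓ _)
PartitionAtMost-split m (suc l) l<m = begin
  PartitionAtMost m m
    ↔⟨ PartitionAtMost-split m l (<⇒≤ l<m) ⟩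
  (PartitionAtMost m (m ∸ l) ⊎ ParcelSum m l)
    ↔⟨ ⊎-cong (PartitionAtMost-suc m (+-∸-assoc 1 l<m)) ↔-refl ⟩
  ((PartitionAtMost m (m ∸ suc l) ⊎ PartitionLargest m (m ∸ l)) ⊎ ParcelSum m l)
    ↔⟨ ⊎-assoc 0ℓ _ _ _ ⟩
  (PartitionAtMost m (m ∸ suc l) ⊎ (PartitionLargest m (m ∸ l) ⊎ ParcelSum m l))
    ↔⟨ ⊎-cong ↔-refl (⊎-comm _ _) ⟩
  (PartitionAtMost m (m ∸ suc l) ⊎ ParcelSum m (suc l)) ∎
  where open EquationalReasoning

Partition↔PartitionAtMost⊎ParcelSum : ∀ m d →
  Partition m ↔ (PartitionAtMost m d ⊎ ParcelSum m (m ∸ d))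
Partition↔PartitionAtMost⊎ParcelSum m d with ≤-total m d
... | inj₁ m≤d rewrite m≤n⇒m∸n≡0 m≤d =
  ↔-trans (Partition↔PartitionAtMost m≤d) (↔-sym (⊎-identityʳ 0ℓ _))
... | inj₂ d≤m = ↔-trans (Partition↔PartitionAtMost ≤-refl)
  (subst (λ k → PartitionAtMost m m ↔ (PartitionAtMost m k ⊎ ParcelSum m (m ∸ d)))
         (m∸[m∸n]≡n d≤m) (PartitionAtMost-split m (m ∸ d) (m∸n≤m m d)))

lam≡∸ : ∀ {n τ} → τ ≤ n → lam n τ ≡ τ ∸ (n ∸ τ)
lam≡∸ {n} {τ} τ≤n = begin
  (τ + τ) ∸ n               ≡⟨ cong ((τ + τ) ∸_) (sym (m+[n∸m]≡n τ≤n)) ⟩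
  (τ + τ) ∸ (τ + (n ∸ τ))   ≡⟨ [m+n]∸[m+o]≡n∸o τ τ (n ∸ τ) ⟩
  τ ∸ (n ∸ τ)               ∎
  where open ≡-Reasoning

mainTheorem1 : (n τ : ℕ) → 1 ≤ n → τ < n →
    (a b : ℕ) (q : ℕ → ℕ) →
    HasCard (PartitionLargest n (n ∸ τ)) a →
    HasCard (Partition τ) b →
    (∀ i → HasCard (PartitionLargest τ (τ ∸ i)) (q i)) →
    a + sumBelow (lam n τ) q ≡ b
mainTheorem1 n τ _ τ<n a b q card-a card-b card-q
  rewrite lam≡∸ (<⇒≤ τ<n) = sym (↔⇒≡ (begin
    Fin b                                          ↔⟨ card-b ⟩
    Partition τ                                    ↔⟨ Partition↔PartitionAtMost⊎ParcelSum τ d ⟩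
    (PartitionAtMost τ d ⊎ ParcelSum τ (τ ∸ d))    ↔⟨ ⊎-cong atMost↔Fin parcels↔Fin ⟩
    (Fin a ⊎ Fin (sumBelow (τ ∸ d) q))             ↔⟨ +↔⊎ ⟨
    Fin (a + sumBelow (τ ∸ d) q)                   ∎))
  where
  open EquationalReasoning
  d : ℕ
  d = n ∸ τ
  largest↔atMost : PartitionLargest n d ↔ PartitionAtMost τ d
  largest↔atMost = subst (λ k → PartitionLargest k d ↔ PartitionAtMost τ d)
    (m∸n+n≡m (<⇒≤ τ<n)) (PartitionLargest↔PartitionAtMost (m<n⇒0<n∸m τ<n))
  atMost↔Fin : PartitionAtMost τ d ↔ Fin a
  atMost↔Fin = ↔-sym (↔-trans card-a largest↔atMost)
  parcels↔Fin : ParcelSum τ (τ ∸ d) ↔ Fin (sumBelow (τ ∸ d) q)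
  parcels↔Fin = ↔-sym (ParcelSum-card q card-q (τ ∸ d))
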